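{- Let $\beta$ be a positive integer and let $\varphi=\varphi_1\times\varphi_2$ be the modified CFLS coloring on $V=\{0,1\}^{\beta^2}$. There do not exist four distinct vertices $a,b,c,d\in V$ with $\varphi(a,b)=\varphi(c,d)$, $\varphi(a,c)=\varphi(b,d)$, and $\varphi(a,d)=\varphi(b,c)$.
   Context: Let $\beta$ be a positive integer and $V=\{0,1\}^{\beta^2}$. For $v\in V$ write $v=(v^{(1)},\ldots,v^{(\beta)})$ where each block $v^{(i)}\in\{0,1\}^\beta$ consists of consecutive bits of $v$. The CFLS coloring is defined, for distinct $x,y\in V$, by $\varphi_1(x,y)=\big((i,\{x^{(i)},y^{(i)}\}), i_1,\ldots,i_\beta\big)$, where $i$ is the first index with $x^{(i)}\neq y^{(i)}$, and for each $k$, $i_k=0$ if $x^{(k)}=y^{(k)}$ and otherwise $i_k$ is the first position at which a bit of $x^{(k)}$ differs from the corresponding bit of $y^{(k)}$. Order $V$ (and likewise each set of blocks $\{0,1\}^\beta$) by regarding each string as the binary representation of an integer: $x<y$ iff at the first bit where $x$ and $y$ differ, $x$ has $0$ and $y$ has $1$. For $x<y$ define $\varphi_2(x,y)=(\delta_1(x,y),\ldots,\delta_\beta(x,y))$, where $\delta_i(x,y)=-1$ if $x^{(i)}>y^{(i)}$ and $\delta_i(x,y)=+1$ if $x^{(i)}\le y^{(i)}$; the color of the edge $\{x,y\}$ is $\varphi_2(\min,\max)$. The modified CFLS coloring is $\varphi(x,y)=(\varphi_1(x,y),\varphi_2(x,y))$. -}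

module Defs where

open import Data.Nat using (ℕ; zero; suc; _*_)
open import Data.Bool using (Bool; true; false; not; if_then_else_)
open import Data.Integer using (ℤ; -1ℤ; 1ℤ)
open import Data.Maybe using (Maybe; just; nothing; map)
open import Data.Product using (_×_; _,_)
open import Data.Vec using (Vec; []; _∷_; splitAt; zipWith)
open import Data.Vec.Properties using (≡-dec)
open import Data.Bool.Properties using () renaming (_≟_ to _≟B_)
open import Relation.Nullary using (yes; no)
open import Relation.Binary.Definitions using (DecidableEquality)

-- Vertex set V = {0,1}^(β²), as flat bit strings (false = 0, true = 1).
V : ℕ → Set
V β = Vec Bool (β * β)

chunks : ∀ {A : Set} (m n : ℕ) → Vec A (m * n) → Vec (Vec A n) m
chunks zero    n xs = []
chunks (suc m) n xs with splitAt n xs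
... | (ys , zs , _) = ys ∷ chunks m n zs

blocks : ∀ {β} → V β → Vec (Vec Bool β) β
blocks {β} v = chunks β β v

-- Binary-integer (lexicographic) strict order on bit strings of equal length.
ltB : ∀ {n} → Vec Bool n → Vec Bool n → Bool
ltB [] [] = false
ltB (false ∷ xs) (false ∷ ys) = ltB xs ys
ltB (true ∷ xs)  (true ∷ ys)  = ltB xs ys
ltB (false ∷ xs) (true ∷ ys)  = true
ltB (true ∷ xs)  (false ∷ ys) = false

-- First index (1-based) at which two vectors differ; 0 if they are equal.
firstDiff : ∀ {A : Set} {n} → DecidableEquality A → Vec A n → Vec A n → ℕ
firstDiff _≟_ [] [] = 0
firstDiff _≟_ (x ∷ xs) (y ∷ ys) with x ≟ y
... | no _  = 1
... | yes _ with firstDiff _≟_ xs ys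
...   | zero  = zero
...   | suc r = suc (suc r)

firstDiffPair : ∀ {A : Set} {n} → DecidableEquality A → Vec A n → Vec A n → Maybe (A × A)
firstDiffPair _≟_ [] [] = nothing
firstDiffPair _≟_ (x ∷ xs) (y ∷ ys) with x ≟ y
... | no _  = just (x , y)
... | yes _ = firstDiffPair _≟_ xs ys

-- Unordered pair {a,b} of blocks, represented canonically as (min , max).
unordered : ∀ {n} → Vec Bool n → Vec Bool n → Vec Bool n × Vec Bool n
unordered a b = if ltB b a then (b , a) else (a , b)

Block : ℕ → Set
Block β = Vec Bool β

-- Colour of φ₁ : ((i , {x^(i), y^(i)}) , i_1 , … , i_β)
Color₁ : ℕ → Set
Color₁ β = (ℕ × Maybe (Block β × Block β)) × Vec ℕ β

φ₁ : ∀ {β} → V β → V β → Color₁ β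
φ₁ {β} x y =
  ( ( firstDiff (≡-dec _≟B_) (blocks {β} x) (blocks {β} y)
    , map (λ p → unordered (Data.Product.proj₁ p) (Data.Product.proj₂ p))
          (firstDiffPair (≡-dec _≟B_) (blocks {β} x) (blocks {β} y)) )
  , zipWith (firstDiff _≟B_) (blocks {β} x) (blocks {β} y) )

δ : ∀ {β} → Block β → Block β → ℤ
δ a b = if ltB b a then -1ℤ else 1ℤ

φ₂ord : ∀ {β} → V β → V β → Vec ℤ β
φ₂ord {β} x y = zipWith δ (blocks {β} x) (blocks {β} y)

-- φ₂ on the edge {x,y}: φ₂(min , max).
φ₂ : ∀ {β} → V β → V β → Vec ℤ β
φ₂ {β} x y = if ltB x y then φ₂ord {β} x y else φ₂ord {β} y x

Color : ℕ → Set
Color β = Color₁ β × Vec ℤ β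

φ : ∀ β → V β → V β → Color β
φ β x y = (φ₁ {β} x y , φ₂ {β} x y)

-- Look at the first block where a, b, c, d do not all agree. Equal φ₁-colours force
-- the two pairs of an equation to differ in the same blocks, with the same unordered
-- pair of blocks at their first difference; so at that block the quadruple splits into
-- two pairs {x, y} and {z, w} with common blocks p ≠ q. Every cross pair is then ordered
-- by p versus q, so φ₂ compares all cross pairs in one fixed orientation. At the first
-- later block where x and y differ, z and w carry the same two blocks, matched either as
-- (x, z), (y, w) or as (x, w), (y, z); either way one equation identifies δ(u, v) with
-- δ(v, u) for distinct blocks u, v, which is impossible.
module Submission where

open import Defs
open import Data.Bool using (Bool; true; false; not)
open import Data.Bool.Properties using () renaming (_≟_ to _≟B_)
open import Data.Empty using (⊥; ⊥-elim)
open import Data.Integer using (ℤ)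
open import Data.Maybe using (Maybe; just; map)
open import Data.Maybe.Properties using (just-injective)
open import Data.Nat using (ℕ; NonZero; zero; suc; _*_)
open import Data.Product using (_×_; _,_; proj₁; proj₂; uncurry)
open import Data.Sum using (_⊎_; inj₁; inj₂)
open import Data.Vec using (Vec; []; _∷_; _++_; concat; zipWith; head; tail; splitAt)
open import Data.Vec.Properties using (≡-dec; zipWith-comm)
open import Function using (_∘_; flip)
open import Relation.Binary.Definitions using (DecidableEquality)
open import Relation.Binary.PropositionalEquality
  using (_≡_; _≢_; refl; sym; trans; cong)
open import Relation.Nullary using (¬_; yes; no)
open import Relation.Nullary.Decidable using (toSum)

_≟V_ : ∀ {n} → DecidableEquality (Block n)
_≟V_ = ≡-dec _≟B_

ltB-flip : ∀ {n} (u v : Vec Bool n) → u ≢ v → ltB v u ≡ not (ltB u v)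
ltB-flip []          []          u≢v = ⊥-elim (u≢v refl)
ltB-flip (false ∷ u) (false ∷ v) u≢v = ltB-flip u v (u≢v ∘ cong (false ∷_))
ltB-flip (true ∷ u)  (true ∷ v)  u≢v = ltB-flip u v (u≢v ∘ cong (true ∷_))
ltB-flip (false ∷ u) (true ∷ v)  _   = refl
ltB-flip (true ∷ u)  (false ∷ v) _   = refl

ltB-++-common : ∀ {n k} (u : Vec Bool n) (P Q : Vec Bool k) → ltB (u ++ P) (u ++ Q) ≡ ltB P Q
ltB-++-common []          P Q = refl
ltB-++-common (false ∷ u) P Q = ltB-++-common u P Q
ltB-++-common (true ∷ u)  P Q = ltB-++-common u P Q

ltB-++-distinct : ∀ {n k} (u v : Vec Bool n) (P Q : Vec Bool k) → u ≢ v →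
                  ltB (u ++ P) (v ++ Q) ≡ ltB u v
ltB-++-distinct []          []          P Q u≢v = ⊥-elim (u≢v refl)
ltB-++-distinct (false ∷ u) (false ∷ v) P Q u≢v =
  ltB-++-distinct u v P Q (u≢v ∘ cong (false ∷_))
ltB-++-distinct (true ∷ u)  (true ∷ v)  P Q u≢v =
  ltB-++-distinct u v P Q (u≢v ∘ cong (true ∷_))
ltB-++-distinct (false ∷ u) (true ∷ v)  P Q _   = refl
ltB-++-distinct (true ∷ u)  (false ∷ v) P Q _   = refl

OrderSensitive : ∀ {A C : Set} → (A → A → C) → Set
OrderSensitive g = ∀ {p q} → p ≢ q → g p q ≢ g q p

δ-orderSensitive : ∀ {n} → OrderSensitive (δ {n})
δ-orderSensitive {p = p} {q} p≢q rewrite ltB-flip p q p≢q with ltB p q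
... | true  = λ ()
... | false = λ ()

orientedδ : ∀ {n} → Bool → Block n → Block n → ℤ
orientedδ true  = δ
orientedδ false = flip δ

orientedδ-orderSensitive : ∀ {n} t → OrderSensitive (orientedδ {n} t)
orientedδ-orderSensitive true  p≢q = δ-orderSensitive p≢q
orientedδ-orderSensitive false p≢q = δ-orderSensitive (p≢q ∘ sym)

orientedδ-flip : ∀ {n} t (p q : Block n) → orientedδ t p q ≡ orientedδ (not t) q p
orientedδ-flip true  p q = refl
orientedδ-flip false p q = refl

unordered-inj : ∀ {n} {a b c d : Block n} → unordered a b ≡ unordered c d →
                (a ≡ c × b ≡ d) ⊎ (a ≡ d × b ≡ c)
unordered-inj {a = a} {b} {c} {d} eq with ltB b a | ltB d c
unordered-inj refl | true  | true  = inj₁ (refl , refl)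
unordered-inj refl | true  | false = inj₂ (refl , refl)
unordered-inj refl | false | true  = inj₂ (refl , refl)
unordered-inj refl | false | false = inj₁ (refl , refl)

module _ {A : Set} (_≟_ : DecidableEquality A) where

  firstDiff-refl : ∀ {n} (u : Vec A n) → firstDiff _≟_ u u ≡ 0
  firstDiff-refl []       = refl
  firstDiff-refl (x ∷ xs) with x ≟ x
  ... | no x≢x = ⊥-elim (x≢x refl)
  ... | yes _ rewrite firstDiff-refl xs = refl

  firstDiff≡0⇒≡ : ∀ {n} (u v : Vec A n) → firstDiff _≟_ u v ≡ 0 → u ≡ v
  firstDiff≡0⇒≡ []       []       _ = refl
  firstDiff≡0⇒≡ (x ∷ xs) (y ∷ ys) e with x ≟ y
  firstDiff≡0⇒≡ (x ∷ xs) (y ∷ ys) () | no _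
  ... | yes refl with firstDiff _≟_ xs ys in eq
  ...   | zero = cong (x ∷_) (firstDiff≡0⇒≡ xs ys eq)
  firstDiff≡0⇒≡ (x ∷ xs) (y ∷ ys) () | yes refl | suc _

  firstDiff-transfers-≡ : ∀ {n} {x y z w : Vec A n} →
                          firstDiff _≟_ x y ≡ firstDiff _≟_ z w → x ≡ y → z ≡ w
  firstDiff-transfers-≡ {x = x} {z = z} {w} e refl =
    firstDiff≡0⇒≡ z w (trans (sym e) (firstDiff-refl x))

  firstDiffPair-∷-same : ∀ {m} (u : A) (X Y : Vec A m) →
                         firstDiffPair _≟_ (u ∷ X) (u ∷ Y) ≡ firstDiffPair _≟_ X Y
  firstDiffPair-∷-same u X Y with u ≟ u
  ... | yes _   = refl
  ... | no u≢u = ⊥-elim (u≢u refl)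

  firstDiffPair-∷-distinct : ∀ {m} {u v : A} (X Y : Vec A m) → u ≢ v →
                             firstDiffPair _≟_ (u ∷ X) (v ∷ Y) ≡ just (u , v)
  firstDiffPair-∷-distinct {u = u} {v} X Y u≢v with u ≟ v
  ... | yes u≡v = ⊥-elim (u≢v u≡v)
  ... | no _    = refl

firstPair : ∀ {n m} → Vec (Block n) m → Vec (Block n) m → Maybe (Block n × Block n)
firstPair X Y = map (uncurry unordered) (firstDiffPair _≟V_ X Y)

diffPositions : ∀ {n m} → Vec (Block n) m → Vec (Block n) m → Vec ℕ m
diffPositions = zipWith (firstDiff _≟B_)

φ₂blocks : ∀ {n m} → Vec (Block n) m → Vec (Block n) m → Vec ℤ m
φ₂blocks X Y = zipWith (orientedδ (ltB (concat X) (concat Y))) X Y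

Colour : ℕ → ℕ → Set
Colour n m = Maybe (Block n × Block n) × Vec ℕ m × Vec ℤ m

pair : ∀ {n m} → Colour n m → Maybe (Block n × Block n)
pair = proj₁

positions : ∀ {n m} → Colour n m → Vec ℕ m
positions = proj₁ ∘ proj₂

signs : ∀ {n m} → Colour n m → Vec ℤ m
signs = proj₂ ∘ proj₂

colour : ∀ {n m} → Vec (Block n) m → Vec (Block n) m → Colour n m
colour X Y = firstPair X Y , diffPositions X Y , φ₂blocks X Y

firstPair-∷-same : ∀ {n m} (u : Block n) (X Y : Vec (Block n) m) →
                   firstPair (u ∷ X) (u ∷ Y) ≡ firstPair X Y
firstPair-∷-same u X Y = cong (map _) (firstDiffPair-∷-same _≟V_ u X Y)

firstPair-∷-distinct : ∀ {n m} {u v : Block n} (X Y : Vec (Block n) m) → u ≢ v →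
                       firstPair (u ∷ X) (v ∷ Y) ≡ just (unordered u v)
firstPair-∷-distinct X Y u≢v = cong (map _) (firstDiffPair-∷-distinct _≟V_ X Y u≢v)

firstPair-heads : ∀ {n m} {x y z w : Block n} {X Y Z W : Vec (Block n) m} → x ≢ y →
                  firstPair (x ∷ X) (y ∷ Y) ≡ firstPair (z ∷ Z) (w ∷ W) →
                  diffPositions (x ∷ X) (y ∷ Y) ≡ diffPositions (z ∷ Z) (w ∷ W) →
                  unordered x y ≡ unordered z w
firstPair-heads {X = X} {Y} {Z = Z} {W} x≢y fp dp = just-injective
  (trans (sym (firstPair-∷-distinct X Y x≢y)) (trans fp (firstPair-∷-distinct Z W z≢w)))
  where
  z≢w = λ z≡w → x≢y (firstDiff-transfers-≡ _≟B_ (sym (cong head dp)) z≡w)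

φ₂blocks-∷-distinct : ∀ {n m} {u v : Block n} (X Y : Vec (Block n) m) → u ≢ v →
                      φ₂blocks (u ∷ X) (v ∷ Y) ≡ zipWith (orientedδ (ltB u v)) (u ∷ X) (v ∷ Y)
φ₂blocks-∷-distinct {u = u} {v} X Y u≢v
  rewrite ltB-++-distinct u v (concat X) (concat Y) u≢v = refl

φ₂blocks-∷-sym : ∀ {n m} (u v : Block n) (X Y : Vec (Block n) m) → u ≢ v →
                 φ₂blocks (u ∷ X) (v ∷ Y) ≡ φ₂blocks (v ∷ Y) (u ∷ X)
φ₂blocks-∷-sym u v X Y u≢v
  rewrite φ₂blocks-∷-distinct X Y u≢v | φ₂blocks-∷-distinct Y X (u≢v ∘ sym)
        | ltB-flip u v u≢v
  = zipWith-comm (orientedδ-flip (ltB u v)) (u ∷ X) (v ∷ Y)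

φ₂blocks-∷-cancel : ∀ {n m} {p q : Block n} {X Y Z W : Vec (Block n) m} → p ≢ q →
                    φ₂blocks (p ∷ X) (q ∷ Z) ≡ φ₂blocks (p ∷ Y) (q ∷ W) →
                    zipWith (orientedδ (ltB p q)) X Z ≡ zipWith (orientedδ (ltB p q)) Y W
φ₂blocks-∷-cancel {X = X} {Y} {Z} {W} p≢q e = cong tail
  (trans (sym (φ₂blocks-∷-distinct X Z p≢q)) (trans e (φ₂blocks-∷-distinct Y W p≢q)))

dropHead : ∀ {n m} → Colour n (suc m) → Colour n m
dropHead (p , ns , zs) = p , tail ns , tail zs

colour-∷-same : ∀ {n m} (u : Block n) (X Y : Vec (Block n) m) →
                dropHead (colour (u ∷ X) (u ∷ Y)) ≡ colour X Y
colour-∷-same u X Y rewrite ltB-++-common u (concat X) (concat Y)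
  = cong (λ p → p , diffPositions X Y , φ₂blocks X Y) (firstPair-∷-same u X Y)

colour-∷-cancel : ∀ {n m} (u v : Block n) {X Y Z W : Vec (Block n) m} →
                  colour (u ∷ X) (u ∷ Y) ≡ colour (v ∷ Z) (v ∷ W) → colour X Y ≡ colour Z W
colour-∷-cancel u v {X} {Y} {Z} {W} e =
  trans (sym (colour-∷-same u X Y)) (trans (cong dropHead e) (colour-∷-same v Z W))

no-crossed-pairs : ∀ {n m} {C : Set} (g : Block n → Block n → C) → OrderSensitive g →
                   (X Y Z W : Vec (Block n) m) → X ≢ Y →
                   firstPair X Y ≡ firstPair Z W → diffPositions X Y ≡ diffPositions Z W →
                   zipWith g X Z ≡ zipWith g Y W → zipWith g X W ≡ zipWith g Y Z → ⊥
no-crossed-pairs g sensitive [] [] [] [] X≢Y _ _ _ _ = X≢Y refl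
-- Splitting on toSum (x ≟V y) rather than x ≟V y keeps 'with' from abstracting the
-- decision that firstPair (x ∷ X) (y ∷ Y) unfolds to in the types of fp and dp.
no-crossed-pairs g sensitive (x ∷ X) (y ∷ Y) (z ∷ Z) (w ∷ W) X≢Y fp dp e₁ e₂
  with toSum (x ≟V y)
... | inj₁ refl with firstDiff-transfers-≡ _≟B_ {x = x} {x} {z} {w} (cong head dp) refl
...   | refl = no-crossed-pairs g sensitive X Y Z W (X≢Y ∘ cong (x ∷_))
                 (trans (sym (firstPair-∷-same x X Y)) (trans fp (firstPair-∷-same z Z W)))
                 (cong tail dp) (cong tail e₁) (cong tail e₂)
no-crossed-pairs g sensitive (x ∷ X) (y ∷ Y) (z ∷ Z) (w ∷ W) X≢Y fp dp e₁ e₂ | inj₂ x≢y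
  with unordered-inj {a = x} {y} {z} {w} (firstPair-heads x≢y fp dp)
... | inj₁ (refl , refl) = sensitive x≢y (cong head e₂)
... | inj₂ (refl , refl) = sensitive x≢y (cong head e₁)

no-quadruple-split-at-head : ∀ {n m} (p q : Block n) {X Y Z W : Vec (Block n) m} →
                             p ≢ q → X ≢ Y →
                             colour (p ∷ X) (p ∷ Y) ≡ colour (q ∷ Z) (q ∷ W) →
                             φ₂blocks (p ∷ X) (q ∷ Z) ≡ φ₂blocks (p ∷ Y) (q ∷ W) →
                             φ₂blocks (p ∷ X) (q ∷ W) ≡ φ₂blocks (p ∷ Y) (q ∷ Z) → ⊥
no-quadruple-split-at-head p q {X} {Y} {Z} {W} p≢q X≢Y e e₁ e₂ =
  no-crossed-pairs (orientedδ (ltB p q)) (orientedδ-orderSensitive (ltB p q)) X Y Z W X≢Y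
    (cong pair tails) (cong positions tails)
    (φ₂blocks-∷-cancel p≢q e₁) (φ₂blocks-∷-cancel p≢q e₂)
  where
  tails : colour X Y ≡ colour Z W
  tails = colour-∷-cancel p q e

no-Klein-quadruple : ∀ {n} m (A B C D : Vec (Block n) m) → A ≢ B → A ≢ C → A ≢ D →
                     colour A B ≡ colour C D → colour A C ≡ colour B D →
                     colour A D ≡ colour B C → ⊥
no-Klein-quadruple zero [] [] [] [] A≢B _ _ _ _ _ = A≢B refl
no-Klein-quadruple (suc m) (a ∷ A) (b ∷ B) (c ∷ C) (d ∷ D) aA≢bB aA≢cC aA≢dD e₁ e₂ e₃
  with toSum (a ≟V b)
... | inj₁ refl
  with firstDiff-transfers-≡ _≟B_ {x = a} {a} {c} {d} (cong (head ∘ positions) e₁) refl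
...   | refl with toSum (a ≟V c)
...     | inj₁ refl = no-Klein-quadruple m A B C D
                        (aA≢bB ∘ cong (a ∷_)) (aA≢cC ∘ cong (a ∷_)) (aA≢dD ∘ cong (a ∷_))
                        (colour-∷-cancel a a e₁) (colour-∷-cancel a a e₂) (colour-∷-cancel a a e₃)
...     | inj₂ a≢c =
  no-quadruple-split-at-head a c a≢c (aA≢bB ∘ cong (a ∷_)) e₁ (cong signs e₂) (cong signs e₃)
no-Klein-quadruple (suc m) (a ∷ A) (b ∷ B) (c ∷ C) (d ∷ D) aA≢bB aA≢cC aA≢dD e₁ e₂ e₃ | inj₂ a≢b
  with unordered-inj {a = a} {b} {c} {d}
         (firstPair-heads a≢b (cong pair e₁) (cong positions e₁))
... | inj₁ (refl , refl) = no-quadruple-split-at-head a b a≢b (aA≢cC ∘ cong (a ∷_)) e₂ (cong signs e₁)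
                             (trans (cong signs e₃) (φ₂blocks-∷-sym b a B C (a≢b ∘ sym)))
... | inj₂ (refl , refl) = no-quadruple-split-at-head a b a≢b (aA≢dD ∘ cong (a ∷_)) e₃
                             (trans (cong signs e₁) (φ₂blocks-∷-sym b a C D (a≢b ∘ sym)))
                             (trans (cong signs e₂) (φ₂blocks-∷-sym b a B D (a≢b ∘ sym)))

concat-chunks : ∀ {A : Set} m n (xs : Vec A (m * n)) → concat (chunks m n xs) ≡ xs
concat-chunks zero    n [] = refl
concat-chunks (suc m) n xs with splitAt n xs
... | ys , zs , xs≡ys++zs = trans (cong (ys ++_) (concat-chunks m n zs)) (sym xs≡ys++zs)

blocks-injective : ∀ {β} {x y : V β} → x ≢ y → blocks {β} x ≢ blocks {β} y
blocks-injective {β} {x} {y} x≢y e =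
  x≢y (trans (sym (concat-chunks β β x)) (trans (cong concat e) (concat-chunks β β y)))

φ₂≡φ₂blocks : ∀ {β} (x y : V β) → φ₂ {β} x y ≡ φ₂blocks (blocks {β} x) (blocks {β} y)
φ₂≡φ₂blocks {β} x y rewrite concat-chunks β β x | concat-chunks β β y with ltB x y
... | true  = refl
... | false = zipWith-comm (λ _ _ → refl) (blocks {β} y) (blocks {β} x)

forgetIndex : ∀ β → Color β → Colour β β
forgetIndex β (((_ , p) , ns) , zs) = p , ns , zs

colour-blocks : ∀ {β} (x y : V β) → colour (blocks {β} x) (blocks {β} y) ≡ forgetIndex β (φ β x y)
colour-blocks {β} x y =
  cong (λ zs → firstPair X Y , diffPositions X Y , zs) (sym (φ₂≡φ₂blocks x y))
  where
  X = blocks {β} x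
  Y = blocks {β} y

colour-respects-φ : ∀ {β} {x y z w : V β} → φ β x y ≡ φ β z w →
                    colour (blocks {β} x) (blocks {β} y) ≡ colour (blocks {β} z) (blocks {β} w)
colour-respects-φ {β} {x} {y} {z} {w} e =
  trans (colour-blocks x y) (trans (cong (forgetIndex β) e) (sym (colour-blocks z w)))

mainTheorem7 : (β : ℕ) → .{{_ : NonZero β}} → (a b c d : V β) →
    a ≢ b → a ≢ c → a ≢ d → b ≢ c → b ≢ d → c ≢ d →
    ¬ ((φ β a b ≡ φ β c d) × (φ β a c ≡ φ β b d) × (φ β a d ≡ φ β b c))
mainTheorem7 β a b c d a≢b a≢c a≢d _ _ _ (e₁ , e₂ , e₃) =
  no-Klein-quadruple β (blocks {β} a) (blocks {β} b) (blocks {β} c) (blocks {β} d)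
    (blocks-injective a≢b) (blocks-injective a≢c) (blocks-injective a≢d)
    (colour-respects-φ e₁) (colour-respects-φ e₂) (colour-respects-φ e₃)
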